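{- For an integer $m\ge 3$, let $G_{4m}$ be the graph with vertex set $\{x,y,z\}\cup\{y_1,\dots,y_{2m-2}\}\cup\{z_1,\dots,z_{2m-1}\}$ and edge set $\{yz\}\cup\{xy_i,\ y_iy: 1\le i\le 2m-2\}\cup\{xz_i,\ z_iz: 1\le i\le 2m-1\}\cup\{y_iy_j: 1\le i<j\le 2m-2,\ j\ne i+m-1\}\cup\{z_iz_{1+((i+m-2)\bmod (2m-1))}: 1\le i\le 2m-1\}\cup\{y_iz_j: 1\le i\le 2m-2,\ 1\le j\le 2m-1,\ j\ne i,\ j\ne i+1\}\cup\{y_1z_2\}$. Then $G_{4m}$ is a $3$-$\gamma_t$-critical graph.
   Context: A set $S\subseteq V(G)$ is a total dominating set of a graph $G$ if every vertex of $G$ is adjacent to some vertex of $S$; $\gamma_t(G)$ is the minimum cardinality of a total dominating set. A graph $G$ is $k$-$\gamma_t$-critical if $\gamma_t(G)=k$ and for every vertex $v$ of $G$ that is not adjacent to a vertex of degree one, $\gamma_t(G-v)=k-1$. (The paper notes $G_{4m}$ has maximum degree $4m-3$ and order $4m=\Delta(G_{4m})+3$.) -}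

module Defs where

open import Data.Nat using (ℕ; zero; suc; _+_; _*_; _∸_; _<ᵇ_; _≡ᵇ_; _%_; _≤_)
open import Data.Nat.Properties using ()
open import Data.Bool using (Bool; true; false; _∨_; _∧_; not; if_then_else_)
open import Data.Fin using (Fin; toℕ)
open import Data.Fin.Subset using (Subset; _∈_; _∉_; ∣_∣)
open import Data.List using (List; map; allFin)
open import Data.Nat.ListAction using (sum)
open import Data.Empty using (⊥)
open import Data.Product using (Σ; _×_; ∃)
open import Relation.Binary.PropositionalEquality using (_≡_; _≢_)

-- Finite graphs on vertex set Fin n (adjacency as a Bool relation).
-- Symmetry/looplessness are not bundled; the concrete graph below is
-- symmetric by construction and loopless for m ≥ 2.

record Graph : Set where
  field
    n     : ℕ
    adj   : Fin n → Fin n → Bool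
open Graph public

Adj : (G : Graph) → Fin (n G) → Fin (n G) → Set
Adj G u v = adj G u v ≡ true

degree : (G : Graph) → Fin (n G) → ℕ
degree G v = sum (map (λ u → if adj G v u then 1 else 0) (allFin (n G)))

IsTDS : (G : Graph) → Subset (n G) → Set
IsTDS G S = ∀ v → Σ (Fin (n G)) λ u → u ∈ S × Adj G v u

TotalDomNumberIs : Graph → ℕ → Set
TotalDomNumberIs G k =
  Σ (Subset (n G)) (λ S → IsTDS G S × ∣ S ∣ ≡ k)
  × (∀ S → IsTDS G S → k ≤ ∣ S ∣)

IsTDS-minus : (G : Graph) → Fin (n G) → Subset (n G) → Set
IsTDS-minus G w S =
  w ∉ S × (∀ v → v ≢ w → Σ (Fin (n G)) λ u → u ∈ S × Adj G v u)

TotalDomNumberMinusIs : (G : Graph) → Fin (n G) → ℕ → Set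
TotalDomNumberMinusIs G w k =
  Σ (Subset (n G)) (λ S → IsTDS-minus G w S × ∣ S ∣ ≡ k)
  × (∀ S → IsTDS-minus G w S → k ≤ ∣ S ∣)

AdjToLeaf : (G : Graph) → Fin (n G) → Set
AdjToLeaf G v = Σ (Fin (n G)) λ u → Adj G v u × degree G u ≡ 1

IsCritical : ℕ → Graph → Set
IsCritical k G =
  TotalDomNumberIs G k
  × (∀ v → (AdjToLeaf G v → ⊥) → TotalDomNumberMinusIs G v (k ∸ 1))

-- The graph G_{4m}, on vertices 0 .. 4m-1 encoded as follows:
--   0 = x, 1 = y, 2 = z,
--   3 + i       = y_{i+1}   for 0 ≤ i ≤ 2m-3,
--   2m + 1 + j  = z_{j+1}   for 0 ≤ j ≤ 2m-2.
-- (Indices i, j below are 0-based.)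

data Lbl : Set where
  X Y Z : Lbl
  Yi Zj : ℕ → Lbl

label : ℕ → ℕ → Lbl
label m 0 = X
label m 1 = Y
label m 2 = Z
label m k = if k <ᵇ (3 + (2 * m ∸ 2)) then Yi (k ∸ 3) else Zj (k ∸ (2 * m + 1))

-- one orientation of each edge listed in the paper (0-based indices)
edge : ℕ → Lbl → Lbl → Bool
edge m Y Z = true
edge m X (Yi i) = true
edge m (Yi i) Y = true
edge m X (Zj j) = true
edge m (Zj j) Z = true
edge m (Yi i) (Yi j) = (i <ᵇ j) ∧ not (j ≡ᵇ (i + (m ∸ 1)))
-- z_i z_{1 + ((i+m-2) mod (2m-1))}   (0-based: j = (i + m - 1) mod (2m-1))
edge m (Zj i) (Zj j) = j ≡ᵇ ((i + (m ∸ 1)) % suc (2 * m ∸ 2))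
edge m (Yi i) (Zj j) =
  (not (j ≡ᵇ i) ∧ not (j ≡ᵇ suc i)) ∨ ((i ≡ᵇ 0) ∧ (j ≡ᵇ 1))
edge m _ _ = false

adjG : (m : ℕ) → Fin (4 * m) → Fin (4 * m) → Bool
adjG m a b =
  edge m (label m (toℕ a)) (label m (toℕ b)) ∨ edge m (label m (toℕ b)) (label m (toℕ a))

G4m : ℕ → Graph
G4m m = record { n = 4 * m ; adj = adjG m }

-- {y, z, y₁} totally dominates G₄ₘ.  Conversely, a total dominating set contains a
-- neighbour a of y and a neighbour b of z; y and z have no common neighbour, so a ≠ b,
-- and for every such pair some vertex is adjacent to neither a nor b, forcing a third
-- element.  For criticality, every vertex w is avoided by a pair dominating all other
-- vertices: {y, z}, {x, z₁} and {x, y₁} for w = x, y, z, and otherwise a pair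
-- {y_k, z_l} with y_k ~ z_l such that z_l is adjacent to every non-neighbour of y_k
-- other than w.  A single vertex never suffices because G₄ₘ has no loops.
module Submission where

open import Defs
open import Data.Bool using (true; false; _∨_; _∧_; not; T)
open import Data.Bool.Properties using (∨-comm; ∨-identityʳ)
import Data.Bool.Properties as Bool
open import Data.Empty using (⊥-elim)
open import Data.Fin using (Fin; toℕ; fromℕ<)
open import Data.Fin.Properties using (toℕ-fromℕ<; toℕ-injective; toℕ<n)
open import Data.Fin.Subset using (Subset; _∈_; _∉_; ∣_∣; ⁅_⁆; _∪_)
open import Data.Fin.Subset.Properties
  using (x∈p∪q⁺; x∈p∪q⁻; x∈⁅x⁆; x∈⁅y⁆⇒x≡y; ∣⁅x⁆∣≡1; x∈p⇒∣p-x∣<∣p∣; x∈p∧x≢y⇒x∈p-y)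
open import Data.Nat
  using (ℕ; suc; _+_; _*_; _∸_; _≤_; _<_; _<ᵇ_; _≡ᵇ_; _%_; z≤n; s≤s; _≟_; _<?_)
open import Data.Nat.Properties
open import Data.Nat.DivMod using (m<n⇒m%n≡m; [m+n]%n≡m%n)
open import Data.Nat.Tactic.RingSolver using (solve-∀)
open import Data.Product using (Σ; ∃; _×_; _,_; proj₁; proj₂)
open import Data.Sum using (_⊎_; inj₁; inj₂)
open import Data.Vec using (_∷_; [])
open import Function using (_∘_; _$_)
open import Relation.Nullary using (¬_; Dec; yes; no)
import Relation.Nullary.Decidable as Dec
open import Relation.Binary using (tri<; tri≈; tri>)
open import Relation.Binary.PropositionalEquality

T⇒≡true : ∀ {b} → T b → b ≡ true
T⇒≡true {true} _ = refl

≡true⇒T : ∀ {b} → b ≡ true → T b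
≡true⇒T refl = _

¬T⇒≡false : ∀ {b} → ¬ T b → b ≡ false
¬T⇒≡false {false} _   = refl
¬T⇒≡false {true}  ¬tt = ⊥-elim (¬tt _)

∨≡true⁻ : ∀ x {y} → x ∨ y ≡ true → x ≡ true ⊎ y ≡ true
∨≡true⁻ true  _ = inj₁ refl
∨≡true⁻ false p = inj₂ p

∧≡true⁻ : ∀ x {y} → x ∧ y ≡ true → x ≡ true × y ≡ true
∧≡true⁻ true p = refl , p

not≡true⁻ : ∀ x → not x ≡ true → x ≡ false
not≡true⁻ false _ = refl

≡⇒≡ᵇ≡true : ∀ {a b} → a ≡ b → (a ≡ᵇ b) ≡ true
≡⇒≡ᵇ≡true {a} {b} = T⇒≡true ∘ ≡⇒≡ᵇ a b

≡ᵇ≡true⇒≡ : ∀ {a b} → (a ≡ᵇ b) ≡ true → a ≡ b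
≡ᵇ≡true⇒≡ {a} {b} = ≡ᵇ⇒≡ a b ∘ ≡true⇒T

≢⇒≡ᵇ≡false : ∀ {a b} → a ≢ b → (a ≡ᵇ b) ≡ false
≢⇒≡ᵇ≡false {a} {b} a≢b = ¬T⇒≡false (a≢b ∘ ≡ᵇ⇒≡ a b)

≡ᵇ≡false⇒≢ : ∀ {a b} → (a ≡ᵇ b) ≡ false → a ≢ b
≡ᵇ≡false⇒≢ {a} p refl with () ← trans (sym p) (≡⇒≡ᵇ≡true {a} refl)

<⇒<ᵇ≡true : ∀ {a b} → a < b → (a <ᵇ b) ≡ true
<⇒<ᵇ≡true = T⇒≡true ∘ <⇒<ᵇ

≥⇒<ᵇ≡false : ∀ {a b} → b ≤ a → (a <ᵇ b) ≡ false
≥⇒<ᵇ≡false {a} {b} b≤a = ¬T⇒≡false (λ t → <⇒≱ (<ᵇ⇒< a b t) b≤a)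

<ᵇ≡true⇒< : ∀ {a b} → (a <ᵇ b) ≡ true → a < b
<ᵇ≡true⇒< {a} {b} = <ᵇ⇒< a b ∘ ≡true⇒T

∣p∪q∣≤∣p∣+∣q∣ : ∀ {n} (p q : Subset n) → ∣ p ∪ q ∣ ≤ ∣ p ∣ + ∣ q ∣
∣p∪q∣≤∣p∣+∣q∣ [] [] = z≤n
∣p∪q∣≤∣p∣+∣q∣ (true ∷ p) (true ∷ q) =
  s≤s (≤-trans (∣p∪q∣≤∣p∣+∣q∣ p q) (+-monoʳ-≤ ∣ p ∣ (n≤1+n ∣ q ∣)))
∣p∪q∣≤∣p∣+∣q∣ (true ∷ p) (false ∷ q) = s≤s (∣p∪q∣≤∣p∣+∣q∣ p q)
∣p∪q∣≤∣p∣+∣q∣ (false ∷ p) (true ∷ q) =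
  ≤-trans (s≤s (∣p∪q∣≤∣p∣+∣q∣ p q)) (≤-reflexive (sym (+-suc ∣ p ∣ ∣ q ∣)))
∣p∪q∣≤∣p∣+∣q∣ (false ∷ p) (false ∷ q) = ∣p∪q∣≤∣p∣+∣q∣ p q

∣⁅x⁆∪⁅y⁆∣≤2 : ∀ {n} (x y : Fin n) → ∣ ⁅ x ⁆ ∪ ⁅ y ⁆ ∣ ≤ 2
∣⁅x⁆∪⁅y⁆∣≤2 x y =
  ≤-trans (∣p∪q∣≤∣p∣+∣q∣ ⁅ x ⁆ ⁅ y ⁆) (≤-reflexive (cong₂ _+_ (∣⁅x⁆∣≡1 x) (∣⁅x⁆∣≡1 y)))

∣⁅x⁆∪⁅y⁆∪⁅z⁆∣≤3 : ∀ {n} (x y z : Fin n) → ∣ ⁅ x ⁆ ∪ (⁅ y ⁆ ∪ ⁅ z ⁆) ∣ ≤ 3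
∣⁅x⁆∪⁅y⁆∪⁅z⁆∣≤3 x y z =
  ≤-trans (∣p∪q∣≤∣p∣+∣q∣ ⁅ x ⁆ (⁅ y ⁆ ∪ ⁅ z ⁆))
          (subst (λ c → c + ∣ ⁅ y ⁆ ∪ ⁅ z ⁆ ∣ ≤ 3) (sym (∣⁅x⁆∣≡1 x)) (s≤s (∣⁅x⁆∪⁅y⁆∣≤2 y z)))

x∈p⇒0<∣p∣ : ∀ {n} {x : Fin n} {p : Subset n} → x ∈ p → 0 < ∣ p ∣
x∈p⇒0<∣p∣ x∈p = ≤-trans (s≤s z≤n) (x∈p⇒∣p-x∣<∣p∣ x∈p)

x∈p∧y∈p∧x≢y⇒2≤∣p∣ : ∀ {n} {x y : Fin n} {p : Subset n} →
                    x ∈ p → y ∈ p → x ≢ y → 2 ≤ ∣ p ∣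
x∈p∧y∈p∧x≢y⇒2≤∣p∣ x∈p y∈p x≢y =
  ≤-trans (s≤s (x∈p⇒0<∣p∣ (x∈p∧x≢y⇒x∈p-y y∈p (x≢y ∘ sym)))) (x∈p⇒∣p-x∣<∣p∣ x∈p)

x∈p∧y∈p∧z∈p∧distinct⇒3≤∣p∣ : ∀ {n} {x y z : Fin n} {p : Subset n} →
                             x ∈ p → y ∈ p → z ∈ p → x ≢ y → x ≢ z → y ≢ z → 3 ≤ ∣ p ∣
x∈p∧y∈p∧z∈p∧distinct⇒3≤∣p∣ x∈p y∈p z∈p x≢y x≢z y≢z =
  ≤-trans (s≤s (x∈p∧y∈p∧x≢y⇒2≤∣p∣ (x∈p∧x≢y⇒x∈p-y y∈p (x≢y ∘ sym))
                                   (x∈p∧x≢y⇒x∈p-y z∈p (x≢z ∘ sym)) y≢z))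
          (x∈p⇒∣p-x∣<∣p∣ x∈p)

<-or-+ : ∀ k i → i < k ⊎ ∃ λ t → i ≡ t + k
<-or-+ k i with i <? k
... | yes i<k = inj₁ i<k
... | no  i≮k = inj₂ (i ∸ k , sym (m∸n+n≡m (≮⇒≥ i≮k)))

module _ (G : Graph) where

  Loopless : Set
  Loopless = ∀ v → ¬ Adj G v v

  -- A dominator of some vertex must itself be dominated, by a different vertex.
  isTDS-minus⇒2≤∣S∣ : Loopless → ∀ {w v} → v ≢ w →
                      ∀ {S} → IsTDS-minus G w S → 2 ≤ ∣ S ∣
  isTDS-minus⇒2≤∣S∣ loopless v≢w (w∉S , dominates) with dominates _ v≢w
  ... | a , a∈S , _ with dominates a (λ where refl → w∉S a∈S)
  ...   | b , b∈S , a~b = x∈p∧y∈p∧x≢y⇒2≤∣p∣ a∈S b∈S (λ where refl → loopless a a~b)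

  isTDS⇒3≤∣S∣ : (y z : Fin (n G)) →
                (∀ {a b} → Adj G y a → Adj G z b →
                  a ≢ b × ∃ λ v → ¬ Adj G v a × ¬ Adj G v b) →
                ∀ S → IsTDS G S → 3 ≤ ∣ S ∣
  isTDS⇒3≤∣S∣ y z separated S dominates with dominates y | dominates z
  ... | a , a∈S , y~a | b , b∈S , z~b with separated y~a z~b
  ...   | a≢b , v , v≁a , v≁b with dominates v
  ...     | c , c∈S , v~c =
    x∈p∧y∈p∧z∈p∧distinct⇒3≤∣p∣ a∈S b∈S c∈S a≢b
      (λ where refl → v≁a v~c) (λ where refl → v≁b v~c)

-- Vertices are addressed by their labels, with 0-based indices: y_i for i < E = 2m-2
-- and z_j for j < N = 2m-1.  The offset d = m-1 governs all the exceptional edges.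
module G₄ₘ (e : ℕ) where

  m d E N : ℕ
  m = 3 + e
  d = m ∸ 1
  E = 2 * m ∸ 2
  N = suc E

  E≡d+d : E ≡ d + d
  E≡d+d = lemma e
    where
    lemma : ∀ e → 1 + e + (3 + e + 0) ≡ (2 + e) + (2 + e)
    lemma = solve-∀

  data Valid : Lbl → Set where
    vx  : Valid X
    vy  : Valid Y
    vz  : Valid Z
    vyᵢ : ∀ {i} → i < E → Valid (Yi i)
    vzⱼ : ∀ {j} → j < N → Valid (Zj j)

  code : Lbl → ℕ
  code X      = 0
  code Y      = 1
  code Z      = 2
  code (Yi i) = 3 + i
  code (Zj j) = 3 + (E + j)

  label-Yi : ∀ {i} → i < E → label m (3 + i) ≡ Yi i
  label-Yi i<E rewrite <⇒<ᵇ≡true i<E = refl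

  label-Zj : ∀ {k} → E ≤ k → label m (3 + k) ≡ Zj (k ∸ E)
  label-Zj {k} E≤k rewrite ≥⇒<ᵇ≡false E≤k = cong (λ c → Zj (k ∸ c)) (+-comm _ 1)

  label-code : ∀ {l} → Valid l → label m (code l) ≡ l
  label-code vx        = refl
  label-code vy        = refl
  label-code vz        = refl
  label-code (vyᵢ i<E) = label-Yi i<E
  label-code (vzⱼ {j} _) = trans (label-Zj (m≤m+n E j)) (cong Zj (m+n∸m≡n E j))

  code-label : ∀ k → code (label m k) ≡ k
  code-label 0 = refl
  code-label 1 = refl
  code-label 2 = refl
  code-label (suc (suc (suc k))) with k <? E
  ... | yes k<E rewrite label-Yi k<E = refl
  ... | no  k≮E rewrite label-Zj (≮⇒≥ k≮E) = cong (3 +_) (m+[n∸m]≡n (≮⇒≥ k≮E))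

  4m≡3+E+N : 4 * m ≡ 3 + (E + N)
  4m≡3+E+N = trans (lemma e) (cong (λ c → 3 + (c + suc c)) (sym E≡d+d))
    where
    lemma : ∀ e → 4 * (3 + e) ≡ 3 + ((2 + e + (2 + e)) + suc (2 + e + (2 + e)))
    lemma = solve-∀

  code<4m : ∀ {l} → Valid l → code l < 4 * m
  code<4m {l} valid = subst (code l <_) (sym 4m≡3+E+N) (bound valid)
    where
    bound : ∀ {l} → Valid l → code l < 3 + (E + N)
    bound vx        = s≤s z≤n
    bound vy        = s≤s (s≤s z≤n)
    bound vz        = s≤s (s≤s (s≤s z≤n))
    bound (vyᵢ i<E) = s≤s (s≤s (s≤s (<-≤-trans i<E (m≤m+n E N))))
    bound (vzⱼ j<N) = s≤s (s≤s (s≤s (+-monoʳ-< E j<N)))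

  valid-label : ∀ k → k < 4 * m → Valid (label m k)
  valid-label 0 _ = vx
  valid-label 1 _ = vy
  valid-label 2 _ = vz
  valid-label (suc (suc (suc k))) k<4m with k <? E
  ... | yes k<E rewrite label-Yi k<E = vyᵢ k<E
  ... | no  k≮E rewrite label-Zj (≮⇒≥ k≮E) =
    vzⱼ (m<n+o⇒m∸n<o k E (+-cancelˡ-< 3 k (E + N) (subst (3 + k <_) 4m≡3+E+N k<4m)))

  V : Set
  V = Fin (4 * m)

  Lv : V → Lbl
  Lv v = label m (toℕ v)

  valid : (v : V) → Valid (Lv v)
  valid v = valid-label (toℕ v) (toℕ<n v)

  Lv-injective : ∀ {u v} → Lv u ≡ Lv v → u ≡ v
  Lv-injective {u} {v} eq =
    toℕ-injective (trans (sym (code-label (toℕ u))) (trans (cong code eq) (code-label (toℕ v))))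

  -- Kept abstract so that subsets built from vertices are not normalised.
  abstract
    vertex : ∀ {l} → Valid l → V
    vertex valid = fromℕ< (code<4m valid)

    Lv-vertex : ∀ {l} (valid : Valid l) → Lv (vertex valid) ≡ l
    Lv-vertex valid = trans (cong (label m) (toℕ-fromℕ< (code<4m valid))) (label-code valid)

  -- A record rather than a plain Boolean equation, so that _~_ is injective and
  -- its arguments can be inferred.
  infix 4 _~_
  record _~_ (a b : Lbl) : Set where
    constructor adjacent
    field holds : edge m a b ∨ edge m b a ≡ true

  ~-sym : ∀ {a b} → a ~ b → b ~ a
  ~-sym {a} {b} (adjacent p) = adjacent (trans (∨-comm (edge m b a) (edge m a b)) p)

  Yi~Yi : ∀ {i k} → i ≢ k → k ≢ i + d → i ≢ k + d → Yi i ~ Yi k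
  Yi~Yi {i} {k} i≢k k≢i+d i≢k+d = adjacent holds
    where
    holds : edge m (Yi i) (Yi k) ∨ edge m (Yi k) (Yi i) ≡ true
    holds with <-cmp i k
    ... | tri< i<k _ _ rewrite <⇒<ᵇ≡true i<k | ≢⇒≡ᵇ≡false k≢i+d = refl
    ... | tri≈ _ i≡k _ = ⊥-elim (i≢k i≡k)
    ... | tri> _ _ k<i rewrite ≥⇒<ᵇ≡false (<⇒≤ k<i) | <⇒<ᵇ≡true k<i | ≢⇒≡ᵇ≡false i≢k+d = refl

  Yi~Yi⁻¹ : ∀ {i k} → Yi i ~ Yi k → i ≢ k × k ≢ i + d × i ≢ k + d
  Yi~Yi⁻¹ {i} {k} (adjacent i~k) with ∨≡true⁻ (edge m (Yi i) (Yi k)) i~k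
  ... | inj₁ p with ∧≡true⁻ (i <ᵇ k) p
  ...   | i<k , k≢i+d = <⇒≢ (<ᵇ≡true⇒< i<k) , ≡ᵇ≡false⇒≢ (not≡true⁻ _ k≢i+d)
                      , <⇒≢ (<-≤-trans (<ᵇ≡true⇒< i<k) (m≤m+n k d))
  Yi~Yi⁻¹ {i} {k} (adjacent i~k) | inj₂ p with ∧≡true⁻ (k <ᵇ i) p
  ...   | k<i , i≢k+d = >⇒≢ (<ᵇ≡true⇒< k<i)
                      , <⇒≢ (<-≤-trans (<ᵇ≡true⇒< k<i) (m≤m+n i d))
                      , ≡ᵇ≡false⇒≢ (not≡true⁻ _ i≢k+d)

  Yi~Zj : ∀ {i j} → j ≢ i → j ≢ suc i → Yi i ~ Zj j
  Yi~Zj {i} {j} j≢i j≢1+i = adjacent holds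
    where
    holds : edge m (Yi i) (Zj j) ∨ false ≡ true
    holds rewrite ≢⇒≡ᵇ≡false j≢i | ≢⇒≡ᵇ≡false j≢1+i = refl

  Yi~Zj⁻¹ : ∀ {i j} → Yi i ~ Zj j → j ≢ i × j ≢ suc i ⊎ i ≡ 0 × j ≡ 1
  Yi~Zj⁻¹ {i} {j} (adjacent i~j) rewrite ∨-identityʳ (edge m (Yi i) (Zj j))
    with ∨≡true⁻ (not (j ≡ᵇ i) ∧ not (j ≡ᵇ suc i)) i~j
  ... | inj₁ p with ∧≡true⁻ (not (j ≡ᵇ i)) p
  ...   | j≢i , j≢1+i = inj₁ (≡ᵇ≡false⇒≢ (not≡true⁻ _ j≢i) , ≡ᵇ≡false⇒≢ (not≡true⁻ _ j≢1+i))
  Yi~Zj⁻¹ {i} {j} (adjacent i~j) | inj₂ p with ∧≡true⁻ (i ≡ᵇ 0) p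
  ...   | i≡0 , j≡1 = inj₂ (≡ᵇ≡true⇒≡ i≡0 , ≡ᵇ≡true⇒≡ j≡1)

  Yi≁Zj : ∀ {i} → ¬ Yi i ~ Zj i
  Yi≁Zj {i} i~i with Yi~Zj⁻¹ {i} i~i
  ... | inj₁ (i≢i , _)  = i≢i refl
  ... | inj₂ (refl , ())

  Yi≁Zj₁₊ : ∀ {i} → i ≢ 0 → ¬ Yi i ~ Zj (suc i)
  Yi≁Zj₁₊ i≢0 i~1+i with Yi~Zj⁻¹ i~1+i
  ... | inj₁ (_ , 1+i≢1+i) = 1+i≢1+i refl
  ... | inj₂ (i≡0 , _)     = i≢0 i≡0

  m+d≡N : m + d ≡ N
  m+d≡N = cong suc (sym E≡d+d)

  -- In the paper's 1-based indexing z_i ~ z_{1+((i+m-2) mod (2m-1))}; 0-based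
  -- this is z_i ~ z_{(i+d) mod N}, which is z_{i+d} for small i and z_{i-m} otherwise.
  shift-low : ∀ {i} → i + d < N → (i + d) % N ≡ i + d
  shift-low = m<n⇒m%n≡m

  shift-high : ∀ {t} → t < N → (t + m + d) % N ≡ t
  shift-high {t} t<N = begin
    (t + m + d) % N ≡⟨ cong (_% N) (trans (+-assoc t m d) (cong (t +_) m+d≡N)) ⟩
    (t + N) % N     ≡⟨ [m+n]%n≡m%n t N ⟩
    t % N           ≡⟨ m<n⇒m%n≡m t<N ⟩
    t               ∎
    where open ≡-Reasoning

  Zj~Zj+d : ∀ {i} → i + d < N → Zj i ~ Zj (i + d)
  Zj~Zj+d {i} i+d<N = adjacent $
    cong (_∨ edge m (Zj (i + d)) (Zj i)) (≡⇒≡ᵇ≡true (sym (shift-low i+d<N)))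

  Zj+m~Zj : ∀ {t} → t + m < N → Zj (t + m) ~ Zj t
  Zj+m~Zj {t} t+m<N = adjacent $
    cong (_∨ edge m (Zj t) (Zj (t + m)))
         (≡⇒≡ᵇ≡true (sym (shift-high (≤-<-trans (m≤m+n t m) t+m<N))))

  shift⁻¹ : ∀ {i j} → i < N → j ≡ (i + d) % N → j ≡ i + d ⊎ i ≡ j + m
  shift⁻¹ {i} i<N j≡ with <-or-+ m i
  ... | inj₁ i<m        = inj₁ (trans j≡ (shift-low (subst (i + d <_) m+d≡N (+-monoˡ-< d i<m))))
  ... | inj₂ (t , refl) =
    inj₂ (cong (_+ m) (sym (trans j≡ (shift-high (≤-<-trans (m≤m+n t m) i<N)))))

  Zj~Zj⁻¹ : ∀ {i j} → i < N → j < N → Zj i ~ Zj j →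
            (j ≡ i + d ⊎ i ≡ j + m) ⊎ (i ≡ j + d ⊎ j ≡ i + m)
  Zj~Zj⁻¹ {i} {j} i<N j<N (adjacent i~j) with ∨≡true⁻ (j ≡ᵇ (i + d) % N) i~j
  ... | inj₁ p = inj₁ (shift⁻¹ i<N (≡ᵇ≡true⇒≡ p))
  ... | inj₂ p = inj₂ (shift⁻¹ j<N (≡ᵇ≡true⇒≡ p))

  Zj≁Zj : ∀ {i j} → i < N → j < N →
          j ≢ i + d → i ≢ j + m → i ≢ j + d → j ≢ i + m → ¬ Zj i ~ Zj j
  Zj≁Zj i<N j<N n₁ n₂ n₃ n₄ i~j with Zj~Zj⁻¹ i<N j<N i~j
  ... | inj₁ (inj₁ eq) = n₁ eq
  ... | inj₁ (inj₂ eq) = n₂ eq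
  ... | inj₂ (inj₁ eq) = n₃ eq
  ... | inj₂ (inj₂ eq) = n₄ eq

  n≢n+d : ∀ {n} → n ≢ n + d
  n≢n+d {n} = m+1+n≢m n ∘ sym

  n≢n+m : ∀ {n} → n ≢ n + m
  n≢n+m {n} = m+1+n≢m n ∘ sym

  ~-irrefl : ∀ {l} → Valid l → ¬ l ~ l
  ~-irrefl vx (adjacent ())
  ~-irrefl vy (adjacent ())
  ~-irrefl vz (adjacent ())
  ~-irrefl (vyᵢ _)   i~i = proj₁ (Yi~Yi⁻¹ i~i) refl
  ~-irrefl (vzⱼ j<N) = Zj≁Zj j<N j<N n≢n+d n≢n+m n≢n+d n≢n+m

  infix 4 _~?_
  _~?_ : ∀ a b → Dec (a ~ b)
  a ~? b = Dec.map′ adjacent _~_.holds (edge m a b ∨ edge m b a Bool.≟ true)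

  G : Graph
  G = G4m m

  loopless : Loopless G
  loopless v = ~-irrefl (valid v) ∘ adjacent

  NeighbourIn : Subset (4 * m) → Lbl → Set
  NeighbourIn S l = Σ Lbl λ a → Σ (Valid a) λ valid-a → vertex valid-a ∈ S × l ~ a

  dominator : ∀ {S v} → NeighbourIn S (Lv v) → Σ V λ u → u ∈ S × Adj G v u
  dominator {v = v} (_ , valid-a , a∈S , v~a) =
    vertex valid-a , a∈S , _~_.holds (subst (Lv v ~_) (sym (Lv-vertex valid-a)) v~a)

  -- Total domination number 3

  d<E : d < E
  d<E = subst (d <_) (sym E≡d+d) (m<m+n d (s≤s z≤n))

  0<E : 0 < E
  0<E = <-trans (s≤s z≤n) d<E

  <E⇒<N : ∀ {i} → i < E → i < N
  <E⇒<N = m<n⇒m<1+n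

  1+n<n+d : ∀ n → suc n < n + d
  1+n<n+d n = subst (_< n + d) (+-comm n 1) (+-monoʳ-< n (s≤s (s≤s z≤n)))

  Zj≁Zj-near : ∀ {a b} → a < b → b < a + d → b < N → ¬ Zj a ~ Zj b
  Zj≁Zj-near {a} {b} a<b b<a+d b<N =
    Zj≁Zj (<-trans a<b b<N) b<N (<⇒≢ b<a+d) (<⇒≢ (<-≤-trans a<b (m≤m+n b m)))
      (<⇒≢ (<-≤-trans a<b (m≤m+n b d))) (<⇒≢ (<-≤-trans b<a+d (+-monoʳ-≤ a (n≤1+n d))))

  Zj≁Zj-far : ∀ {a b} → b + m < a → a < N → ¬ Zj a ~ Zj b
  Zj≁Zj-far {a} {b} b+m<a a<N =
    Zj≁Zj a<N (<-trans b<a a<N) (<⇒≢ (<-≤-trans b<a (m≤m+n a d))) (>⇒≢ b+m<a)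
      (>⇒≢ (≤-<-trans (+-monoʳ-≤ b (n≤1+n d)) b+m<a)) (<⇒≢ (<-≤-trans b<a (m≤m+n a m)))
    where
    b<a : b < a
    b<a = ≤-<-trans (m≤m+n b m) b+m<a

  UndominatedBy : Lbl → Lbl → Set
  UndominatedBy a b = Σ Lbl λ l → Valid l × ¬ l ~ a × ¬ l ~ b

  -- Generically z_i is adjacent to neither; the other cases are exactly those where
  -- z_i ~ z_j.
  Yi-Zj-undominated : ∀ {i j} → i < E → j < N → UndominatedBy (Yi i) (Zj j)
  Yi-Zj-undominated {i} {j} i<E j<N
    with j ≟ i + d | i ≟ 0 | j ≟ i + m | i ≟ j + d | i ≟ j + m
  ... | yes refl | yes refl | _ | _ | _ =
    Yi d , vyᵢ d<E , (λ d~0 → proj₂ (proj₂ (Yi~Yi⁻¹ d~0)) refl) , Yi≁Zj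
  ... | yes refl | no i≢0 | _ | _ | _ =
    Zj (suc i) , vzⱼ (s≤s i<E) , Yi≁Zj₁₊ i≢0 ∘ ~-sym , Zj≁Zj-near (1+n<n+d i) (n<1+n (i + d)) j<N
  ... | no _ | _ | yes refl | _ | _ =
    Yi (i + d) , vyᵢ i+d<E , (λ i+d~i → proj₂ (proj₂ (Yi~Yi⁻¹ i+d~i)) refl)
    , subst (λ c → ¬ Yi (i + d) ~ Zj c) (sym (+-suc i d)) (Yi≁Zj₁₊ (m+1+n≢0 i))
    where
    i+d<E : i + d < E
    i+d<E = ≤-pred (subst (_< N) (+-suc i d) j<N)
  ... | no _ | _ | no _ | yes refl | _ =
    Yi j , vyᵢ (≤-<-trans (m≤m+n j d) i<E) , (λ j~i → proj₁ (proj₂ (Yi~Yi⁻¹ j~i)) refl) , Yi≁Zj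
  ... | no _ | _ | no _ | no _ | yes refl =
    Zj (suc i) , vzⱼ (s≤s i<E) , Yi≁Zj₁₊ (m+1+n≢0 j) ∘ ~-sym , Zj≁Zj-far (n<1+n i) (s≤s i<E)
  ... | no n₁ | _ | no n₄ | no n₃ | no n₂ =
    Zj i , vzⱼ (<E⇒<N i<E) , Yi≁Zj ∘ ~-sym , Zj≁Zj (<E⇒<N i<E) j<N n₁ n₂ n₃ n₄

  y-z-neighbours-separated : ∀ {a b} → Valid a → Valid b → Y ~ a → Z ~ b →
                             a ≢ b × UndominatedBy a b
  y-z-neighbours-separated vx _ (adjacent ())
  y-z-neighbours-separated vy _ (adjacent ())
  y-z-neighbours-separated (vzⱼ _) _ (adjacent ())
  y-z-neighbours-separated _ vx _ (adjacent ())
  y-z-neighbours-separated _ vz _ (adjacent ())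
  y-z-neighbours-separated _ (vyᵢ _) _ (adjacent ())
  y-z-neighbours-separated vz vy _ _ =
    (λ ()) , X , vx , (λ { (adjacent ()) }) , (λ { (adjacent ()) })
  y-z-neighbours-separated vz (vzⱼ {0} _) _ _ =
    (λ ()) , Yi 0 , vyᵢ 0<E , (λ { (adjacent ()) }) , Yi≁Zj
  y-z-neighbours-separated vz (vzⱼ {1} _) _ _ =
    (λ ()) , Yi 1 , vyᵢ (<-trans (s≤s (s≤s z≤n)) d<E) , (λ { (adjacent ()) }) , Yi≁Zj
  y-z-neighbours-separated vz (vzⱼ {suc (suc j)} (s≤s 2+j≤E)) _ _ =
    (λ ()) , Yi (suc j) , vyᵢ 2+j≤E , (λ { (adjacent ()) }) , Yi≁Zj₁₊ (λ ())
  y-z-neighbours-separated (vyᵢ i<E) vy _ _ =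
    (λ ()) , Zj _ , vzⱼ (<E⇒<N i<E) , Yi≁Zj ∘ ~-sym , (λ { (adjacent ()) })
  y-z-neighbours-separated (vyᵢ i<E) (vzⱼ j<N) _ _ = (λ ()) , Yi-Zj-undominated i<E j<N

  γₜ≥3 : ∀ S → IsTDS G S → 3 ≤ ∣ S ∣
  γₜ≥3 = isTDS⇒3≤∣S∣ G (vertex vy) (vertex vz) separated
    where
    separated : ∀ {a b} → Adj G (vertex vy) a → Adj G (vertex vz) b →
                a ≢ b × ∃ λ v → ¬ Adj G v a × ¬ Adj G v b
    separated {a} {b} y~a z~b
      with y-z-neighbours-separated (valid a) (valid b)
             (subst (_~ Lv a) (Lv-vertex vy) (adjacent y~a))
             (subst (_~ Lv b) (Lv-vertex vz) (adjacent z~b))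
    ... | a≢b , l , valid-l , l≁a , l≁b =
      a≢b ∘ cong Lv , vertex valid-l ,
      (l≁a ∘ subst (_~ Lv a) (Lv-vertex valid-l) ∘ adjacent) ,
      (l≁b ∘ subst (_~ Lv b) (Lv-vertex valid-l) ∘ adjacent)

  γₜ≡3 : TotalDomNumberIs G 3
  γₜ≡3 = (S , isTDS , ≤-antisym ∣S∣≤3 (γₜ≥3 S isTDS)) , γₜ≥3
    where
    valid-y₀ : Valid (Yi 0)
    valid-y₀ = vyᵢ 0<E

    S : Subset (4 * m)
    S = ⁅ vertex vy ⁆ ∪ (⁅ vertex vz ⁆ ∪ ⁅ vertex valid-y₀ ⁆)

    ∣S∣≤3 : ∣ S ∣ ≤ 3
    ∣S∣≤3 = ∣⁅x⁆∪⁅y⁆∪⁅z⁆∣≤3 (vertex vy) (vertex vz) (vertex valid-y₀)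

    y∈S : vertex vy ∈ S
    y∈S = x∈p∪q⁺ (inj₁ (x∈⁅x⁆ _))
    z∈S : vertex vz ∈ S
    z∈S = x∈p∪q⁺ (inj₂ (x∈p∪q⁺ (inj₁ (x∈⁅x⁆ _))))
    y₀∈S : vertex valid-y₀ ∈ S
    y₀∈S = x∈p∪q⁺ (inj₂ (x∈p∪q⁺ (inj₂ (x∈⁅x⁆ _))))

    isTDS : IsTDS G S
    isTDS v = dominator {S} {v} (neighbour (valid v))
      where
      neighbour : ∀ {l} → Valid l → NeighbourIn S l
      neighbour vx      = _ , valid-y₀ , y₀∈S , adjacent refl
      neighbour vy      = _ , vz , z∈S , adjacent refl
      neighbour vz      = _ , vy , y∈S , adjacent refl
      neighbour (vyᵢ _) = _ , vy , y∈S , adjacent refl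
      neighbour (vzⱼ _) = _ , vz , z∈S , adjacent refl

  -- Vertex-deleted subgraphs

  vertex≢ : ∀ {l} (valid-l : Valid l) {w} → l ≢ Lv w → vertex valid-l ≢ w
  vertex≢ valid-l l≢w eq = l≢w (trans (sym (Lv-vertex valid-l)) (cong Lv eq))

  record PairDominatingAllBut (w : Lbl) : Set where
    field
      {a b}   : Lbl
      valid-a : Valid a
      valid-b : Valid b
      a≢w     : a ≢ w
      b≢w     : b ≢ w
      covers  : ∀ {l} → Valid l → l ≢ w → ¬ l ~ a → l ~ b

  γₜ-minus≡2 : ∀ w → PairDominatingAllBut (Lv w) → TotalDomNumberMinusIs G w 2
  γₜ-minus≡2 w pair = (S , isTDS , ≤-antisym ∣S∣≤2 (γₜ≥2 S isTDS)) , γₜ≥2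
    where
    open PairDominatingAllBut pair

    S : Subset (4 * m)
    S = ⁅ vertex valid-a ⁆ ∪ ⁅ vertex valid-b ⁆

    ∣S∣≤2 : ∣ S ∣ ≤ 2
    ∣S∣≤2 = ∣⁅x⁆∪⁅y⁆∣≤2 (vertex valid-a) (vertex valid-b)

    γₜ≥2 : ∀ S → IsTDS-minus G w S → 2 ≤ ∣ S ∣
    γₜ≥2 S = isTDS-minus⇒2≤∣S∣ G loopless (vertex≢ valid-a a≢w)

    w∉S : w ∉ S
    w∉S w∈S with x∈p∪q⁻ ⁅ vertex valid-a ⁆ ⁅ vertex valid-b ⁆ w∈S
    ... | inj₁ w∈⁅a⁆ = vertex≢ valid-a a≢w (sym (x∈⁅y⁆⇒x≡y _ w∈⁅a⁆))
    ... | inj₂ w∈⁅b⁆ = vertex≢ valid-b b≢w (sym (x∈⁅y⁆⇒x≡y _ w∈⁅b⁆))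

    neighbour : ∀ v → v ≢ w → NeighbourIn S (Lv v)
    neighbour v v≢w with Lv v ~? a
    ... | yes v~a = _ , valid-a , x∈p∪q⁺ (inj₁ (x∈⁅x⁆ _)) , v~a
    ... | no  v≁a =
      _ , valid-b , x∈p∪q⁺ (inj₂ (x∈⁅x⁆ _)) , covers (valid v) (v≢w ∘ Lv-injective) v≁a

    isTDS : IsTDS-minus G w S
    isTDS = w∉S , λ v v≢w → dominator {S} {v} (neighbour v v≢w)

  Yi-injective : ∀ {i j} → Yi i ≡ Yi j → i ≡ j
  Yi-injective refl = refl

  Zj-injective : ∀ {i j} → Zj i ≡ Zj j → i ≡ j
  Zj-injective refl = refl

  <d⇒+d<E : ∀ {n} → n < d → n + d < E
  <d⇒+d<E {n} n<d = subst (n + d <_) (sym E≡d+d) (+-monoˡ-< d n<d)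

  d≤⇒+d≮E : ∀ {n} → d ≤ n → ¬ n + d < E
  d≤⇒+d≮E {n} d≤n n+d<E = <⇒≱ n+d<E (subst (_≤ n + d) (sym E≡d+d) (+-monoˡ-≤ d d≤n))

  <d⇒≢+d : ∀ {n i} → n < d → n ≢ i + d
  <d⇒≢+d {i = i} n<d refl = <⇒≱ n<d (m≤n+m d i)

  -- The non-neighbours of y_k are z, y_k, y_{k±d}, z_k and z_{k+1}; those other
  -- than w must be neighbours of z_l.
  Yi-Zj-pair : ∀ {w} k l → k < E → l < N → l ≢ k → l ≢ suc k → Yi k ≢ w → Zj l ≢ w →
               (k + d < E → Yi (k + d) ≢ w → Yi (k + d) ~ Zj l) →
               (∀ {i} → k ≡ i + d → Yi i ≢ w → Yi i ~ Zj l) →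
               (Zj k ≢ w → Zj k ~ Zj l) →
               (suc k < N → Zj (suc k) ≢ w → Zj (suc k) ~ Zj l) →
               PairDominatingAllBut w
  Yi-Zj-pair {w} k l k<E l<N l≢k l≢1+k yₖ≢w zₗ≢w y₊ y₋ zₖ zₖ₊₁ = record
    { valid-a = vyᵢ k<E ; valid-b = vzⱼ l<N ; a≢w = yₖ≢w ; b≢w = zₗ≢w ; covers = covers }
    where
    covers : ∀ {u} → Valid u → u ≢ w → ¬ u ~ Yi k → u ~ Zj l
    covers vx _ x≁yₖ = ⊥-elim (x≁yₖ (adjacent refl))
    covers vy _ y≁yₖ = ⊥-elim (y≁yₖ (adjacent refl))
    covers vz _ _    = adjacent refl
    covers (vyᵢ {i} i<E) u≢w u≁yₖ with i ≟ k | i ≟ k + d | k ≟ i + d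
    ... | yes refl | _        | _          = Yi~Zj l≢k l≢1+k
    ... | no _     | yes refl | _          = y₊ i<E u≢w
    ... | no _     | no _     | yes k≡i+d  = y₋ k≡i+d u≢w
    ... | no i≢k   | no i≢k+d | no k≢i+d   = ⊥-elim (u≁yₖ (Yi~Yi i≢k k≢i+d i≢k+d))
    covers (vzⱼ {j} j<N) u≢w u≁yₖ with j ≟ k | j ≟ suc k
    ... | yes refl | _        = zₖ u≢w
    ... | no _     | yes refl = zₖ₊₁ j<N u≢w
    ... | no j≢k   | no j≢1+k = ⊥-elim (u≁yₖ (~-sym (Yi~Zj j≢k j≢1+k)))

  pair-without-x : PairDominatingAllBut X
  pair-without-x = record
    { valid-a = vy ; valid-b = vz ; a≢w = λ () ; b≢w = λ () ; covers = covers }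
    where
    covers : ∀ {u} → Valid u → u ≢ X → ¬ u ~ Y → u ~ Z
    covers vx      u≢x _   = ⊥-elim (u≢x refl)
    covers vy      _   _   = adjacent refl
    covers vz      _   z≁y = ⊥-elim (z≁y (adjacent refl))
    covers (vyᵢ _) _   u≁y = ⊥-elim (u≁y (adjacent refl))
    covers (vzⱼ _) _   _   = adjacent refl

  pair-without-y : PairDominatingAllBut Y
  pair-without-y = record
    { valid-a = vx ; valid-b = vzⱼ (s≤s z≤n) ; a≢w = λ () ; b≢w = λ () ; covers = covers }
    where
    covers : ∀ {u} → Valid u → u ≢ Y → ¬ u ~ X → u ~ Zj 0
    covers vx      _   _   = adjacent refl
    covers vy      u≢y _   = ⊥-elim (u≢y refl)
    covers vz      _   _   = adjacent refl
    covers (vyᵢ _) _   u≁x = ⊥-elim (u≁x (adjacent refl))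
    covers (vzⱼ _) _   u≁x = ⊥-elim (u≁x (adjacent refl))

  pair-without-z : PairDominatingAllBut Z
  pair-without-z = record
    { valid-a = vx ; valid-b = vyᵢ 0<E ; a≢w = λ () ; b≢w = λ () ; covers = covers }
    where
    covers : ∀ {u} → Valid u → u ≢ Z → ¬ u ~ X → u ~ Yi 0
    covers vx      _   _   = adjacent refl
    covers vy      _   _   = adjacent refl
    covers vz      u≢z _   = ⊥-elim (u≢z refl)
    covers (vyᵢ _) _   u≁x = ⊥-elim (u≁x (adjacent refl))
    covers (vzⱼ _) _   u≁x = ⊥-elim (u≁x (adjacent refl))

  pair-without-Yi-low : ∀ {i} → i < d → PairDominatingAllBut (Yi i)
  pair-without-Yi-low {i} i<d =
    Yi-Zj-pair (i + d) i (<d⇒+d<E i<d) (<E⇒<N (<-trans i<d d<E)) n≢n+d (<⇒≢ (s≤s (m≤m+n i d)))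
      (n≢n+d ∘ sym ∘ Yi-injective) (λ ())
      (λ i+d+d<E _ → ⊥-elim (d≤⇒+d≮E (m≤n+m d i) i+d+d<E))
      (λ i+d≡i′+d yᵢ′≢yᵢ → ⊥-elim (yᵢ′≢yᵢ (cong Yi (sym (+-cancelʳ-≡ d i _ i+d≡i′+d)))))
      (λ _ → ~-sym (Zj~Zj+d (<E⇒<N (<d⇒+d<E i<d))))
      (λ 1+i+d<N _ → subst (λ c → Zj c ~ Zj i) (+-suc i d)
                           (Zj+m~Zj (subst (_< N) (sym (+-suc i d)) 1+i+d<N)))

  pair-without-Yi-high : ∀ {t} → t < d → PairDominatingAllBut (Yi (t + d))
  pair-without-Yi-high {t} t<d =
    Yi-Zj-pair t (t + m) (<-trans t<d d<E) t+m<N (n≢n+m ∘ sym)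
      (λ eq → n≢n+d (sym (suc-injective (trans (sym (+-suc t d)) eq))))
      (n≢n+d ∘ Yi-injective) (λ ())
      (λ _ yₜ₊d≢yₜ₊d → ⊥-elim (yₜ₊d≢yₜ₊d refl))
      (λ t≡i+d _ → ⊥-elim (<d⇒≢+d t<d t≡i+d))
      (λ _ → ~-sym (Zj+m~Zj t+m<N))
      (λ _ _ → subst (λ c → Zj (suc t) ~ Zj c) (sym (+-suc t d)) (Zj~Zj+d (s≤s (<d⇒+d<E t<d))))
    where
    t+m<N : t + m < N
    t+m<N = subst (_< N) (sym (+-suc t d)) (s≤s (<d⇒+d<E t<d))

  pair-without-Zj-low : ∀ {j} → suc j < d → PairDominatingAllBut (Zj j)
  pair-without-Zj-low {j} 1+j<d =
    Yi-Zj-pair j (suc j + m) (<-trans j<d d<E) l<N l≢j l≢1+j (λ ()) (l≢j ∘ Zj-injective)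
      (λ _ _ → Yi~Zj (>⇒≢ (s≤s (+-monoʳ-≤ j (n≤1+n d)))) (>⇒≢ (s≤s (+-monoʳ-< j (n<1+n d)))))
      (λ j≡i+d _ → ⊥-elim (<d⇒≢+d j<d j≡i+d))
      (λ zⱼ≢zⱼ → ⊥-elim (zⱼ≢zⱼ refl))
      (λ _ _ → ~-sym (Zj+m~Zj l<N))
    where
    j<d : j < d
    j<d = <-trans (n<1+n j) 1+j<d
    l<N : suc j + m < N
    l<N = s≤s (subst (_< E) (sym (+-suc j d)) (<d⇒+d<E 1+j<d))
    l≢j : suc j + m ≢ j
    l≢j = >⇒≢ (s≤s (m≤m+n j m))
    l≢1+j : suc j + m ≢ suc j
    l≢1+j = >⇒≢ (s≤s (m<m+n j (s≤s z≤n)))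

  pair-without-Zj[d-1] : PairDominatingAllBut (Zj (suc e))
  pair-without-Zj[d-1] =
    Yi-Zj-pair (suc e) 0 (<-trans (n<1+n (suc e)) d<E) (s≤s z≤n) (λ ()) (λ ()) (λ ()) (λ ())
      (λ _ _ → Yi~Zj (λ ()) (λ ()))
      (λ 1+e≡i+d _ → ⊥-elim (<d⇒≢+d (n<1+n (suc e)) 1+e≡i+d))
      (λ zⱼ≢zⱼ → ⊥-elim (zⱼ≢zⱼ refl))
      (λ _ _ → ~-sym (Zj~Zj+d (<E⇒<N d<E)))

  -- This is where the extra edge y₁z₂ (0-based: y₀z₁) is used.
  pair-without-Zj[d] : PairDominatingAllBut (Zj d)
  pair-without-Zj[d] =
    Yi-Zj-pair d 1 d<E (<E⇒<N (<-trans (s≤s (s≤s z≤n)) d<E)) (λ ()) (λ ()) (λ ()) (λ ())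
      (λ d+d<E _ → ⊥-elim (d≤⇒+d≮E ≤-refl d+d<E))
      (λ {i} d≡i+d _ → subst (λ c → Yi c ~ Zj 1) (+-cancelʳ-≡ d 0 i d≡i+d) (adjacent refl))
      (λ zⱼ≢zⱼ → ⊥-elim (zⱼ≢zⱼ refl))
      (λ _ _ → ~-sym (Zj~Zj+d (s≤s d<E)))

  pair-without-Zj[d+1] : PairDominatingAllBut (Zj (suc d))
  pair-without-Zj[d+1] =
    Yi-Zj-pair d (d + d) d<E d+d<N (n≢n+d ∘ sym) (>⇒≢ (1+n<n+d d))
      (λ ()) (>⇒≢ (1+n<n+d d) ∘ Zj-injective)
      (λ d+d<E _ → ⊥-elim (d≤⇒+d≮E ≤-refl d+d<E))
      (λ {i} d≡i+d _ → subst (λ c → Yi c ~ Zj (d + d)) (+-cancelʳ-≡ d 0 i d≡i+d)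
                              (Yi~Zj (λ ()) (λ ())))
      (λ _ → Zj~Zj+d d+d<N)
      (λ _ zⱼ≢zⱼ → ⊥-elim (zⱼ≢zⱼ refl))
    where
    d+d<N : d + d < N
    d+d<N = subst (_< N) E≡d+d (n<1+n E)

  pair-without-Zj-high : ∀ {t} → suc (t + m) < N → PairDominatingAllBut (Zj (suc (t + m)))
  pair-without-Zj-high {t} 1+t+m<N =
    Yi-Zj-pair (t + m) t t+m<E t<N n≢n+m t≢1+t+m (λ ()) (t≢1+t+m ∘ Zj-injective)
      (λ t+m+d<E _ → ⊥-elim (d≤⇒+d≮E (≤-trans (n≤1+n d) (m≤n+m m t)) t+m+d<E))
      (λ {i} t+m≡i+d _ → subst (λ c → Yi c ~ Zj t)
                                (+-cancelʳ-≡ d (suc t) i (trans (sym (+-suc t d)) t+m≡i+d))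
                                (Yi~Zj (<⇒≢ (n<1+n t)) (<⇒≢ (s≤s (n≤1+n t)))))
      (λ _ → Zj+m~Zj (<E⇒<N t+m<E))
      (λ _ zⱼ≢zⱼ → ⊥-elim (zⱼ≢zⱼ refl))
    where
    t+m<E : t + m < E
    t+m<E = ≤-pred 1+t+m<N
    t<N : t < N
    t<N = <E⇒<N (≤-<-trans (m≤m+n t m) t+m<E)
    t≢1+t+m : t ≢ suc (t + m)
    t≢1+t+m = <⇒≢ (s≤s (m≤m+n t m))

  pair-without : ∀ {w} → Valid w → PairDominatingAllBut w
  pair-without vx = pair-without-x
  pair-without vy = pair-without-y
  pair-without vz = pair-without-z
  pair-without (vyᵢ {i} i<E) with <-or-+ d i
  ... | inj₁ i<d        = pair-without-Yi-low i<d
  ... | inj₂ (t , refl) = pair-without-Yi-high (+-cancelʳ-< d t d (subst (t + d <_) E≡d+d i<E))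
  pair-without (vzⱼ {j} j<N) with <-or-+ (suc e) j
  ... | inj₁ j<1+e                      = pair-without-Zj-low (s≤s j<1+e)
  ... | inj₂ (0 , refl)                 = pair-without-Zj[d-1]
  ... | inj₂ (1 , refl)                 = pair-without-Zj[d]
  ... | inj₂ (2 , refl)                 = pair-without-Zj[d+1]
  ... | inj₂ (suc (suc (suc t)) , refl) =
    subst (PairDominatingAllBut ∘ Zj) (sym j≡1+t+m)
          (pair-without-Zj-high (subst (_< N) j≡1+t+m j<N))
    where
    j≡1+t+m : 3 + t + suc e ≡ suc (t + m)
    j≡1+t+m = cong suc (sym (trans (+-suc t (2 + e)) (cong suc (+-suc t (suc e)))))

theorem2p8 : (m : ℕ) → 3 ≤ m → IsCritical 3 (G4m m)
theorem2p8 _ (s≤s (s≤s (s≤s {n = e} _))) = γₜ≡3 , λ w _ → γₜ-minus≡2 w (pair-without (valid w))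
  where open G₄ₘ e
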